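{- Let $\mathcal{C}\subseteq 2^V$ be a hypergraph satisfying the circuit axioms (C1) $\emptyset\notin\mathcal{C}$; (C2) no member of $\mathcal{C}$ is a proper subset of another; (C3) if $C_1,C_2\in\mathcal{C}$ are distinct and $u\in C_1\cap C_2$ then some $C_3\in\mathcal{C}$ satisfies $C_3\subseteq (C_1\cup C_2)\setminus\{u\}$. Let $h=\Phi_{\mathcal{C}}$. Then (a) $\mathcal{K}(h)=\mathcal{C}^{dc}$; (b) $\mathcal{M}(h)=\mathcal{C}^{dcdc}$; (c) $\mathcal{T}(h)=\left(\mathcal{C}^{dcdc}\right)^{\cap}$.
   Context: Boolean functions on $V$ are viewed as functions of subsets; $\mathcal{T}(f)$ is the family of true sets. The definite Horn clause $B\to v$ ($v\notin B$) has true sets exactly the $T$ with $B\not\subseteq T$ or $B\cup\{v\}\subseteq T$; $\Phi_{\mathcal{H}}=\bigwedge_{H\in\mathcal{H}}\bigwedge_{v\in H}((H\setminus\{v\})\to v)$. For a definite Horn function $h$, $\mathbb{T}_h(Z)$ is the smallest true set containing $Z$; $\mathcal{K}(h)$ is the family of inclusion-minimal $K$ with $\mathbb{T}_h(K)=V$; $\mathcal{M}(h)$ is the family of inclusion-maximal true sets different from $V$. For a hypergraph $\mathcal{H}$: $\mathcal{H}^c=\{V\setminus H:H\in\mathcal{H}\}$, $\mathcal{H}^d$ is the family of inclusion-minimal transversals of $\mathcal{H}$, operators compose left to right (e.g. $\mathcal{H}^{dc}=(\mathcal{H}^d)^c$), and $\mathcal{H}^\cap$ is the family of intersections of all subfamilies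 (empty intersection $=V$). -}

module Defs where

open import Data.Nat using (ℕ)
open import Data.Fin using (Fin)
open import Data.Fin.Subset public
  using (Subset; _∈_; _∉_; _⊆_; _⊂_; _∩_; _∪_; _-_; ⁅_⁆; ∁; ⊤; ⋂)
open import Data.List using (List)
open import Data.List.Relation.Unary.All using (All)
import Data.List.Membership.Propositional as LM
open import Data.Product using (Σ; ∃; _×_)
open import Data.Sum using (_⊎_)
open import Relation.Nullary using (¬_)
open import Relation.Binary.PropositionalEquality using (_≡_; _≢_)
open import Function.Bundles using (_⇔_)

-- Ground set V = Fin n. A hypergraph (family of subsets of V) is a
-- predicate on subsets.
Family : ℕ → Set₁
Family n = Subset n → Set

_≐_ : ∀ {n} → Family n → Family n → Set
A ≐ B = ∀ S → A S ⇔ B S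

listFam : ∀ {n} → List (Subset n) → Family n
listFam Cs S = S LM.∈ Cs

-- A Boolean function on V viewed as a function of subsets: its family of
-- true sets.
BoolFun : ℕ → Set₁
BoolFun = Family

TrueSets : ∀ {n} → BoolFun n → Family n
TrueSets f = f

record CircuitAxioms {n} (𝒞 : Family n) : Set where
  field
    C1 : ¬ 𝒞 (Data.Fin.Subset.⊥)
    C2 : ∀ C₁ C₂ → 𝒞 C₁ → 𝒞 C₂ → ¬ (C₁ ⊂ C₂)
    C3 : ∀ C₁ C₂ u → 𝒞 C₁ → 𝒞 C₂ → C₁ ≢ C₂ → u ∈ C₁ → u ∈ C₂ →
         ∃ λ C₃ → 𝒞 C₃ × C₃ ⊆ (C₁ ∪ C₂) - u

-- The definite Horn clause B → v, as a Boolean function: T is true iff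
-- B ⊈ T or B ∪ {v} ⊆ T.
horn : ∀ {n} → Subset n → Fin n → BoolFun n
horn B v T = ¬ (B ⊆ T) ⊎ (B ∪ ⁅ v ⁆ ⊆ T)

Φ : ∀ {n} → Family n → BoolFun n
Φ 𝓗 T = ∀ H → 𝓗 H → ∀ v → v ∈ H → horn (H - v) v T

IsClosure : ∀ {n} → BoolFun n → Subset n → Subset n → Set
IsClosure h Z T = h T × Z ⊆ T × (∀ T′ → h T′ → Z ⊆ T′ → T ⊆ T′)

Minimal : ∀ {n} → Family n → Family n
Minimal P K = P K × (∀ K′ → P K′ → K′ ⊆ K → K′ ≡ K)

Maximal : ∀ {n} → Family n → Family n
Maximal P K = P K × (∀ K′ → P K′ → K ⊆ K′ → K′ ≡ K)

𝒦 : ∀ {n} → BoolFun n → Family n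
𝒦 h = Minimal (λ K → Σ (Subset _) λ T → IsClosure h K T × T ≡ ⊤)

ℳ : ∀ {n} → BoolFun n → Family n
ℳ h = Maximal (λ T → h T × T ≢ ⊤)

_ᶜ : ∀ {n} → Family n → Family n
(𝓗 ᶜ) S = ∃ λ H → 𝓗 H × S ≡ ∁ H

Transversal : ∀ {n} → Family n → Subset _ → Set
Transversal 𝓗 T = ∀ H → 𝓗 H → ∃ λ x → x ∈ T × x ∈ H

_ᵈ : ∀ {n} → Family n → Family n
𝓗 ᵈ = Minimal (Transversal 𝓗)

-- 𝓗^∩: intersections of all (finite) subfamilies; empty intersection = V.
_^∩ : ∀ {n} → Family n → Family n
(𝓗 ^∩) S = ∃ λ (Hs : List (Subset _)) → All 𝓗 Hs × S ≡ ⋂ Hs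

-- The circuits 𝒞 define a matroid whose closed sets (flats) are exactly the true sets of Φ_𝒞.
-- The key fact is that for independent I and y ∉ I, y ∈ cl I iff I ∪ {y} contains a circuit;
-- the nontrivial direction holds because I ∪ {y | I ∪ {y} has a circuit through y} is already
-- closed, a consequence of strong circuit elimination, which is derived from (C3) by induction
-- on C₁ ∪ C₂. Hence 𝒦(h) consists of the minimal spanning sets, which are the bases (maximal
-- independent sets); ℳ(h) consists of the hyperplanes, i.e. the maximal non-spanning sets,
-- i.e. the maximal sets containing no basis; and every flat F is the intersection of the
-- hyperplanes cl(B − x) with x ∉ F. For any hypergraph 𝓗, 𝓗^{dc} is the family of maximal sets
-- containing no edge of 𝓗, which turns these descriptions into 𝒞^{dc}, 𝒞^{dcdc} and (𝒞^{dcdc})^∩.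

module Submission where

open import Defs
open import Data.Nat using (ℕ)
open import Data.Bool using (true)
open import Data.Empty using (⊥-elim)
open import Data.Fin using (Fin; zero; suc; _≟_)
open import Data.Fin.Subset using (⊥; Nonempty; _⊃_)
open import Data.Fin.Subset.Properties
  using (_∈?_; _⊆?_; _⊂?_; ⊆-refl; ⊆-reflexive; ⊆-trans; ⊆-antisym; ⊆⊤; ∈⊤; ⊥⊆; x∈⁅x⁆; x∈⁅y⁆⇒x≡y;
         x∈p∪q⁺; x∈p∪q⁻; x∈p∩q⁺; x∈p∩q⁻; p⊆p∪q; q⊆p∪q; p∩q⊆p; p∩q⊆q; p─q⊆p; x∈p∧x≢y⇒x∈p-y;
         x∉p⇒x∈∁p; x∈∁p⇒x∉p; p⊆q⇒∁p⊇∁q; nonempty?; Empty-unique; anySubset?; ∪-∩-booleanAlgebra)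
open import Data.Fin.Subset.Induction using (⊂-wellFounded; ⊃-wellFounded; Acc; acc)
import Data.Fin.Properties as Fin
open import Data.List using (List; []; _∷_; allFin)
open import Data.List.Membership.Propositional using (find; lose) renaming (_∈_ to _∈L_)
open import Data.List.Membership.Propositional.Properties using (∈-allFin)
open import Data.List.Relation.Unary.All as All using (All; []; _∷_)
import Data.List.Relation.Unary.Any as Any
open import Data.List.Relation.Unary.Any using (here; there)
open import Data.Product using (Σ; ∃; _×_; _,_; proj₁; proj₂)
open import Data.Sum using (_⊎_; inj₁; inj₂; [_,_]′)
open import Data.Vec using (_∷_; tabulate)
import Data.Vec.Base as Vec
open import Data.Vec.Properties using (lookup⇒[]=; []=⇒lookup; lookup∘tabulate)
open import Function using (_∘_)
open import Function.Bundles using (_⇔_; mk⇔; Equivalence)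
open import Function.Properties.Equivalence using (⇔-isEquivalence)
open import Relation.Binary using (IsEquivalence; Setoid)
import Relation.Binary.Reasoning.Setoid as SetoidReasoning
open import Relation.Binary.PropositionalEquality using (_≡_; _≢_; refl; sym; trans; cong; subst)
open import Relation.Nullary using (¬_; Dec; yes; no; does; ¬?; contradiction)
open import Relation.Nullary.Decidable using (_×-dec_; _⊎-dec_; _→-dec_; dec-true; decidable-stable)
import Relation.Nullary.Decidable as Dec
open import Relation.Unary using (Decidable)
import Algebra.Lattice.Properties.BooleanAlgebra as BooleanAlgebra

open Equivalence using (to; from)

private
  variable
    n : ℕ
    x y : Fin n
    p q r S T K : Subset n
    P Q 𝓕 𝓖 : Family n

-- Subsets

∁-involutive : (p : Subset n) → ∁ (∁ p) ≡ p
∁-involutive {n} = BooleanAlgebra.¬-involutive (∪-∩-booleanAlgebra n)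

∁-injective : ∁ p ≡ ∁ q → p ≡ q
∁-injective {p = p} {q} ∁p≡∁q = trans (sym (∁-involutive p)) (trans (cong ∁ ∁p≡∁q) (∁-involutive q))

p⊆∁q⇒q⊆∁p : p ⊆ ∁ q → q ⊆ ∁ p
p⊆∁q⇒q⊆∁p p⊆∁q x∈q = x∉p⇒x∈∁p (λ x∈p → x∈∁p⇒x∉p (p⊆∁q x∈p) x∈q)

x∈p∪q∧x∉p⇒x∈q : x ∈ p ∪ q → x ∉ p → x ∈ q
x∈p∪q∧x∉p⇒x∈q {p = p} {q} x∈p∪q x∉p = [ ⊥-elim ∘ x∉p , (λ x∈q → x∈q) ]′ (x∈p∪q⁻ p q x∈p∪q)

x∈p∪q∧x∉q⇒x∈p : x ∈ p ∪ q → x ∉ q → x ∈ p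
x∈p∪q∧x∉q⇒x∈p {p = p} {q} x∈p∪q x∉q = [ (λ x∈p → x∈p) , ⊥-elim ∘ x∉q ]′ (x∈p∪q⁻ p q x∈p∪q)

∪-least : p ⊆ r → q ⊆ r → p ∪ q ⊆ r
∪-least {p = p} {q = q} p⊆r q⊆r x∈p∪q = [ p⊆r , q⊆r ]′ (x∈p∪q⁻ p q x∈p∪q)

⊆∪⇒∩∁⊆ : p ⊆ q ∪ r → p ∩ ∁ r ⊆ q ∩ ∁ r
⊆∪⇒∩∁⊆ {p = p} {q} {r} p⊆q∪r x∈ with x∈p∩q⁻ p (∁ r) x∈
... | x∈p , x∈∁r = x∈p∩q⁺ (x∈p∪q∧x∉q⇒x∈p (p⊆q∪r x∈p) (x∈∁p⇒x∉p x∈∁r) , x∈∁r)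

∪⊂ : p ⊆ r → q ⊆ r → x ∈ r → x ∉ p → x ∉ q → p ∪ q ⊂ r
∪⊂ {p = p} {q = q} p⊆r q⊆r x∈r x∉p x∉q = ∪-least p⊆r q⊆r , _ , x∈r , [ x∉p , x∉q ]′ ∘ x∈p∪q⁻ p q

⊈-witness : ¬ p ⊆ q → ∃ λ x → x ∈ p × x ∉ q
⊈-witness {p = p} {q} p⊈q with Fin.any? (λ x → x ∈? p ×-dec ¬? (x ∈? q))
... | yes w = w
... | no ∄ = contradiction (λ {x} x∈p → decidable-stable (x ∈? q) (λ x∉q → ∄ (x , x∈p , x∉q))) p⊈q

⊆∧⊈⇒⊂ : p ⊆ q → ¬ q ⊆ p → p ⊂ q
⊆∧⊈⇒⊂ p⊆q q⊈p = p⊆q , ⊈-witness q⊈p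

≢⊥⇒Nonempty : p ≢ ⊥ → Nonempty p
≢⊥⇒Nonempty {p = p} p≢⊥ = decidable-stable (nonempty? p) (p≢⊥ ∘ Empty-unique)

y∉p-y : (p : Subset n) (y : Fin n) → y ∉ p - y
y∉p-y (_ ∷ p) zero    ()
y∉p-y (_ ∷ p) (suc y) (Vec.there y∈p-y) = y∉p-y p y y∈p-y

p-y⊆p : p - y ⊆ p
p-y⊆p {p = p} {y = y} = p─q⊆p p ⁅ y ⁆

x∈p-y⇒x≢y : x ∈ p - y → x ≢ y
x∈p-y⇒x≢y {p = p} x∈p-y refl = y∉p-y p _ x∈p-y

-‿mono : p ⊆ q → p - y ⊆ q - y
-‿mono p⊆q x∈p-y = x∈p∧x≢y⇒x∈p-y (p⊆q (p-y⊆p x∈p-y)) (x∈p-y⇒x≢y x∈p-y)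

⊆-y⇒⊆ : p ⊆ q - y → p ⊆ q
⊆-y⇒⊆ p⊆q-y = ⊆-trans p⊆q-y p-y⊆p

⊆-y⇒∉ : p ⊆ q - y → y ∉ p
⊆-y⇒∉ p⊆q-y y∈p = x∈p-y⇒x≢y (p⊆q-y y∈p) refl

y∈p∪⁅y⁆ : y ∈ p ∪ ⁅ y ⁆
y∈p∪⁅y⁆ {y = y} = x∈p∪q⁺ (inj₂ (x∈⁅x⁆ y))

p⊆p∪⁅y⁆ : p ⊆ p ∪ ⁅ y ⁆
p⊆p∪⁅y⁆ {y = y} = p⊆p∪q ⁅ y ⁆

x∈p∪⁅y⁆⁻ : x ∈ p ∪ ⁅ y ⁆ → x ∈ p ⊎ x ≡ y
x∈p∪⁅y⁆⁻ {p = p} {y = y} x∈ = [ inj₁ , inj₂ ∘ x∈⁅y⁆⇒x≡y y ]′ (x∈p∪q⁻ p ⁅ y ⁆ x∈)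

∪⁅⁆-least : p ⊆ q → y ∈ q → p ∪ ⁅ y ⁆ ⊆ q
∪⁅⁆-least p⊆q y∈q x∈ = [ p⊆q , (λ { refl → y∈q }) ]′ (x∈p∪⁅y⁆⁻ x∈)

p⊆p-y∪⁅y⁆ : p ⊆ (p - y) ∪ ⁅ y ⁆
p⊆p-y∪⁅y⁆ {y = y} {x} x∈p with x ≟ y
... | yes refl = y∈p∪⁅y⁆
... | no  x≢y  = p⊆p∪⁅y⁆ (x∈p∧x≢y⇒x∈p-y x∈p x≢y)

⊆∪⁅y⁆∧y∉⇒⊆ : p ⊆ q ∪ ⁅ y ⁆ → y ∉ p → p ⊆ q
⊆∪⁅y⁆∧y∉⇒⊆ p⊆ y∉p x∈p = [ (λ x∈q → x∈q) , (λ { refl → contradiction x∈p y∉p }) ]′ (x∈p∪⁅y⁆⁻ (p⊆ x∈p))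

⊆∪⁅y⁆⇒-y⊆ : p ⊆ q ∪ ⁅ y ⁆ → p - y ⊆ q
⊆∪⁅y⁆⇒-y⊆ {p = p} {y = y} p⊆ = ⊆∪⁅y⁆∧y∉⇒⊆ (⊆-trans p-y⊆p p⊆) (y∉p-y p y)

p∪q-y⊆p∪r : q ⊆ r ∪ ⁅ y ⁆ → (p ∪ q) - y ⊆ p ∪ r
p∪q-y⊆p∪r {q = q} {p = p} q⊆r∪y x∈ with x∈p∪q⁻ p q (p-y⊆p x∈)
... | inj₁ x∈p = p⊆p∪q _ x∈p
... | inj₂ x∈q = q⊆p∪q p _ (⊆∪⁅y⁆⇒-y⊆ q⊆r∪y (x∈p∧x≢y⇒x∈p-y x∈q (x∈p-y⇒x≢y x∈)))

∀Subset? : Decidable P → Dec (∀ S → P S)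
∀Subset? P? = Dec.map (mk⇔ (λ ∄ S → decidable-stable (P? S) (λ ¬pS → ∄ (S , ¬pS)))
                           (λ all (S , ¬pS) → ¬pS (all S)))
                      (¬? (anySubset? (¬? ∘ P?)))

⟦_⟧ : {P : Fin n → Set} → Decidable P → Subset n
⟦ P? ⟧ = tabulate (does ∘ P?)

module _ {P : Fin n → Set} (P? : Decidable P) where

  ∈⟦⟧⁺ : P x → x ∈ ⟦ P? ⟧
  ∈⟦⟧⁺ {x} px = lookup⇒[]= x _ (trans (lookup∘tabulate _ x) (dec-true (P? x) px))

  ∈⟦⟧⁻ : x ∈ ⟦ P? ⟧ → P x
  ∈⟦⟧⁻ {x} x∈ = witness (P? x) (trans (sym (lookup∘tabulate _ x)) ([]=⇒lookup x∈))
    where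
    witness : (px? : Dec (P x)) → does px? ≡ true → P x
    witness (yes px) _ = px

∃∈? : {A : Set} {P : A → Set} → Decidable P → (xs : List A) → Dec (∃ λ x → x ∈L xs × P x)
∃∈? P? xs = Dec.map (mk⇔ find (λ (_ , x∈xs , px) → lose x∈xs px)) (Any.any? P? xs)

∀∈? : {A : Set} {P : A → Set} → Decidable P → (xs : List A) → Dec (∀ x → x ∈L xs → P x)
∀∈? P? xs = Dec.map (mk⇔ (λ ps x x∈xs → All.lookup ps x∈xs) (λ ps → All.tabulate (ps _)))
                    (All.all? P? xs)

-- Families of subsets

≐-isEquivalence : IsEquivalence (_≐_ {n})
≐-isEquivalence = record
  { refl  = λ S → ⇔.refl
  ; sym   = λ 𝓕≐𝓖 S → ⇔.sym (𝓕≐𝓖 S)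
  ; trans = λ 𝓕≐𝓖 𝓖≐𝓗 S → ⇔.trans (𝓕≐𝓖 S) (𝓖≐𝓗 S)
  }
  where module ⇔ = IsEquivalence ⇔-isEquivalence

≐-setoid : ℕ → Setoid _ _
≐-setoid n = record { isEquivalence = ≐-isEquivalence {n} }

module ≐-Reasoning {n : ℕ} = SetoidReasoning (≐-setoid n)

Minimal-resp-≐ : P ≐ Q → Minimal P ≐ Minimal Q
Minimal-resp-≐ P≐Q S = mk⇔
  (λ (pS , min) → to (P≐Q S) pS , λ K qK K⊆S → min K (from (P≐Q K) qK) K⊆S)
  (λ (qS , min) → from (P≐Q S) qS , λ K pK K⊆S → min K (to (P≐Q K) pK) K⊆S)

Maximal-resp-≐ : P ≐ Q → Maximal P ≐ Maximal Q
Maximal-resp-≐ P≐Q S = mk⇔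
  (λ (pS , max) → to (P≐Q S) pS , λ K qK S⊆K → max K (from (P≐Q K) qK) S⊆K)
  (λ (qS , max) → from (P≐Q S) qS , λ K pK S⊆K → max K (to (P≐Q K) pK) S⊆K)

^∩-resp-≐ : 𝓕 ≐ 𝓖 → (𝓕 ^∩) ≐ (𝓖 ^∩)
^∩-resp-≐ 𝓕≐𝓖 S = mk⇔
  (λ (Hs , 𝓕Hs , S≡) → Hs , All.map (to (𝓕≐𝓖 _)) 𝓕Hs , S≡)
  (λ (Hs , 𝓖Hs , S≡) → Hs , All.map (from (𝓕≐𝓖 _)) 𝓖Hs , S≡)

ᶜ≐∘∁ : (𝓕 ᶜ) ≐ (𝓕 ∘ ∁)
ᶜ≐∘∁ {𝓕 = 𝓕} S = mk⇔
  (λ { (H , 𝓕H , refl) → subst 𝓕 (sym (∁-involutive H)) 𝓕H })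
  (λ 𝓕∁S → ∁ S , 𝓕∁S , sym (∁-involutive S))

Minimal∘∁≐Maximal : (Minimal P ∘ ∁) ≐ Maximal (P ∘ ∁)
Minimal∘∁≐Maximal {P = P} S = mk⇔
  (λ (pS , min) → pS , λ K p∁K S⊆K → ∁-injective (min (∁ K) p∁K (p⊆q⇒∁p⊇∁q S⊆K)))
  (λ (pS , max) → pS , λ K pK K⊆∁S →
     ∁-injective (trans (max (∁ K) (subst P (sym (∁-involutive K)) pK) (p⊆∁q⇒q⊆∁p K⊆∁S))
                        (sym (∁-involutive S))))

Avoids : Family n → Family n
Avoids 𝓗 S = ∀ H → 𝓗 H → ¬ H ⊆ S

Avoids-resp-≐ : 𝓕 ≐ 𝓖 → Avoids 𝓕 ≐ Avoids 𝓖
Avoids-resp-≐ 𝓕≐𝓖 S = mk⇔ (λ av H 𝓖H → av H (from (𝓕≐𝓖 H) 𝓖H))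
                           (λ av H 𝓕H → av H (to (𝓕≐𝓖 H) 𝓕H))

Transversal∘∁≐Avoids : (Transversal 𝓕 ∘ ∁) ≐ Avoids 𝓕
Transversal∘∁≐Avoids {𝓕 = 𝓕} S = mk⇔
  (λ (meets : Transversal 𝓕 (∁ S)) H 𝓕H H⊆S → let x , x∈∁S , x∈H = meets H 𝓕H in x∈∁p⇒x∉p x∈∁S (H⊆S x∈H))
  (λ av H 𝓕H → let x , x∈H , x∉S = ⊈-witness (av H 𝓕H) in x , x∉p⇒x∈∁p x∉S , x∈H)

ᵈᶜ≐Maximal-Avoids : ((𝓕 ᵈ) ᶜ) ≐ Maximal (Avoids 𝓕)
ᵈᶜ≐Maximal-Avoids {𝓕 = 𝓕} = begin
  (𝓕 ᵈ) ᶜ                      ≈⟨ ᶜ≐∘∁ ⟩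
  Minimal (Transversal 𝓕) ∘ ∁  ≈⟨ Minimal∘∁≐Maximal ⟩
  Maximal (Transversal 𝓕 ∘ ∁)  ≈⟨ Maximal-resp-≐ Transversal∘∁≐Avoids ⟩
  Maximal (Avoids 𝓕)           ∎
  where open ≐-Reasoning

Maximal-above : Decidable P → P S → ∃ λ T → Maximal P T × S ⊆ T
Maximal-above {P = P} P? = go (⊃-wellFounded _)
  where
  go : Acc _⊃_ S → P S → ∃ λ T → Maximal P T × S ⊆ T
  go {S} (acc larger) pS with anySubset? (λ T → P? T ×-dec S ⊂? T)
  ... | yes (T , pT , S⊂T) = let U , maxU , T⊆U = go (larger S⊂T) pT in U , maxU , ⊆-trans (proj₁ S⊂T) T⊆U
  ... | no ∄ = S , (pS , λ T pT S⊆T → ⊆-antisym (T⊆S pT S⊆T) S⊆T) , ⊆-refl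
    where
    T⊆S : P T → S ⊆ T → T ⊆ S
    T⊆S {T} pT S⊆T = decidable-stable (T ⊆? S) (λ T⊈S → ∄ (T , pT , ⊆∧⊈⇒⊂ S⊆T T⊈S))

⋂-separating : (∀ {x} → x ∉ S → ∃ λ H → P H × S ⊆ H × x ∉ H) → ∃ λ Hs → All P Hs × S ≡ ⋂ Hs
⋂-separating {S = S} {P = P} separate =
  let Hs , pHs , S⊆⋂ , cut = go (allFin _) in
  Hs , pHs , ⊆-antisym S⊆⋂ (λ {x} x∈⋂ → decidable-stable (x ∈? S) (λ x∉S → cut (∈-allFin x) x∉S x∈⋂))
  where
  go : (xs : List (Fin _)) → ∃ λ Hs → All P Hs × S ⊆ ⋂ Hs × (∀ {x} → x ∈L xs → x ∉ S → x ∉ ⋂ Hs)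
  go [] = [] , [] , ⊆⊤ , λ ()
  go (x ∷ xs) with x ∈? S | go xs
  ... | yes x∈S | Hs , pHs , S⊆⋂ , cut =
    Hs , pHs , S⊆⋂ , λ { (here refl) x∉S → contradiction x∈S x∉S ; (there y∈xs) → cut y∈xs }
  ... | no x∉S | Hs , pHs , S⊆⋂ , cut with H , pH , S⊆H , x∉H ← separate x∉S =
    H ∷ Hs , pH ∷ pHs , (λ y∈S → x∈p∩q⁺ (S⊆H y∈S , S⊆⋂ y∈S)) , λ
      { (here refl) _     y∈⋂ → x∉H (proj₁ (x∈p∩q⁻ H (⋂ Hs) y∈⋂))
      ; (there y∈xs) y∉S y∈⋂ → cut y∈xs y∉S (proj₂ (x∈p∩q⁻ H (⋂ Hs) y∈⋂)) }

-- Closure under definite Horn clauses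

horn⇔ : ∀ {B : Subset n} {v T} → horn B v T ⇔ (B ⊆ T → v ∈ T)
horn⇔ {B = B} {v} {T} = mk⇔ fire clause
  where
  fire : horn B v T → B ⊆ T → v ∈ T
  fire (inj₁ B⊈T)   B⊆T = ⊥-elim (B⊈T B⊆T)
  fire (inj₂ B∪v⊆T) _   = B∪v⊆T y∈p∪⁅y⁆
  clause : (B ⊆ T → v ∈ T) → horn B v T
  clause implies with B ⊆? T
  ... | yes B⊆T = inj₂ (∪⁅⁆-least B⊆T (implies B⊆T))
  ... | no  B⊈T = inj₁ B⊈T

module HornClosure {n} (𝓗 : List (Subset n)) where

  Closed : Subset n → Set
  Closed = Φ (listFam 𝓗)

  closed-rule : Closed T → ∀ {H v} → H ∈L 𝓗 → v ∈ H → H - v ⊆ T → v ∈ T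
  closed-rule closedT H∈𝓗 v∈H = to horn⇔ (closedT _ H∈𝓗 _ v∈H)

  closed-intro : (∀ {H v} → H ∈L 𝓗 → v ∈ H → H - v ⊆ T → v ∈ T) → Closed T
  closed-intro rules H H∈𝓗 v v∈H = from horn⇔ (rules H∈𝓗 v∈H)

  Closed? : Decidable Closed
  Closed? T = ∀∈? (λ H → Fin.all? (λ v → v ∈? H →-dec (¬? (H - v ⊆? T) ⊎-dec (H - v) ∪ ⁅ v ⁆ ⊆? T))) 𝓗

  Closed-⋂ : ∀ {Ts} → All Closed Ts → Closed (⋂ Ts)
  Closed-⋂ [] = closed-intro (λ _ _ _ → ∈⊤)
  Closed-⋂ {T ∷ Ts} (closedT ∷ closedTs) = closed-intro λ H∈𝓗 v∈H H-v⊆ → x∈p∩q⁺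
    ( closed-rule closedT H∈𝓗 v∈H (⊆-trans H-v⊆ (p∩q⊆p T (⋂ Ts)))
    , closed-rule (Closed-⋂ closedTs) H∈𝓗 v∈H (⊆-trans H-v⊆ (p∩q⊆q T (⋂ Ts))))

  InClosure : Subset n → Fin n → Set
  InClosure K x = ∀ T → Closed T → K ⊆ T → x ∈ T

  InClosure? : ∀ K x → Dec (InClosure K x)
  InClosure? K x = ∀Subset? (λ T → Closed? T →-dec (K ⊆? T →-dec x ∈? T))

  cl : Subset n → Subset n
  cl K = ⟦ InClosure? K ⟧

  cl-extensive : K ⊆ cl K
  cl-extensive {K} x∈K = ∈⟦⟧⁺ (InClosure? K) (λ _ _ K⊆T → K⊆T x∈K)

  cl-least : Closed T → K ⊆ T → cl K ⊆ T
  cl-least {T} {K} closedT K⊆T x∈clK = ∈⟦⟧⁻ (InClosure? K) x∈clK T closedT K⊆T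

  cl-closed : Closed (cl K)
  cl-closed {K} = closed-intro λ H∈𝓗 v∈H H-v⊆clK → ∈⟦⟧⁺ (InClosure? K) λ T closedT K⊆T →
    closed-rule closedT H∈𝓗 v∈H (⊆-trans H-v⊆clK (cl-least closedT K⊆T))

  cl-mono : K ⊆ S → cl K ⊆ cl S
  cl-mono K⊆S = cl-least cl-closed (⊆-trans K⊆S cl-extensive)

  cl-rule : ∀ {H v} → H ∈L 𝓗 → v ∈ H → H - v ⊆ K → v ∈ cl K
  cl-rule H∈𝓗 v∈H H-v⊆K = closed-rule cl-closed H∈𝓗 v∈H (⊆-trans H-v⊆K cl-extensive)

  cl-isClosure : IsClosure Closed K (cl K)
  cl-isClosure {K} = cl-closed , (λ {x} → cl-extensive {K} {x}) , λ _ → cl-least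

  IsClosure⇒≡cl : IsClosure Closed K T → T ≡ cl K
  IsClosure⇒≡cl (closedT , K⊆T , least) = ⊆-antisym (least _ cl-closed cl-extensive) (cl-least closedT K⊆T)

  Spanning : Subset n → Set
  Spanning K = ⊤ ⊆ cl K

  closure-≡⊤≐Spanning : (λ K → Σ (Subset n) λ T → IsClosure Closed K T × T ≡ ⊤) ≐ Spanning
  closure-≡⊤≐Spanning K = mk⇔
    (λ (T , isClosure , T≡⊤) → ⊆-reflexive (trans (sym T≡⊤) (IsClosure⇒≡cl isClosure)))
    (λ (spanning : Spanning K) → cl K , cl-isClosure , ⊆-antisym {j = ⊤} ⊆⊤ spanning)

  Spanning-⊤ : Spanning ⊤
  Spanning-⊤ = cl-extensive

  Spanning-⊆cl : K ⊆ cl S → Spanning K → Spanning S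
  Spanning-⊆cl K⊆clS spanning = ⊆-trans spanning (cl-least cl-closed K⊆clS)

  Spanning-mono : K ⊆ S → Spanning K → Spanning S
  Spanning-mono K⊆S = Spanning-⊆cl (⊆-trans K⊆S cl-extensive)

  Closed∧Spanning⇒≡⊤ : Closed T → Spanning T → T ≡ ⊤
  Closed∧Spanning⇒≡⊤ closedT spanning = ⊆-antisym {j = ⊤} ⊆⊤ (⊆-trans spanning (cl-least closedT ⊆-refl))

  ¬Spanning⇒≢⊤ : ¬ Spanning T → T ≢ ⊤
  ¬Spanning⇒≢⊤ ¬spanning T≡⊤ = ¬spanning (subst Spanning (sym T≡⊤) Spanning-⊤)

  ¬Spanning⇒¬Spanning-cl : ¬ Spanning K → ¬ Spanning (cl K)
  ¬Spanning⇒¬Spanning-cl ¬spanning = ¬spanning ∘ Spanning-⊆cl ⊆-refl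

  ℳ≐Maximal-¬Spanning : ℳ Closed ≐ Maximal (¬_ ∘ Spanning)
  ℳ≐Maximal-¬Spanning S = mk⇔
    (λ ((closedS , S≢⊤) , max) → (S≢⊤ ∘ Closed∧Spanning⇒≡⊤ closedS) , λ X ¬spanningX S⊆X →
       let clX≡S = max (cl X) (cl-closed , ¬Spanning⇒≢⊤ (¬Spanning⇒¬Spanning-cl ¬spanningX))
                           (⊆-trans S⊆X cl-extensive)
       in ⊆-antisym (⊆-trans cl-extensive (⊆-reflexive clX≡S)) S⊆X)
    (λ (¬spanningS , max) →
       ( subst Closed (max (cl S) (¬Spanning⇒¬Spanning-cl ¬spanningS) cl-extensive) cl-closed
       , ¬Spanning⇒≢⊤ ¬spanningS)
       , λ G (closedG , G≢⊤) S⊆G → max G (G≢⊤ ∘ Closed∧Spanning⇒≡⊤ closedG) S⊆G)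

-- The matroid of a circuit family

module Matroid {n} (𝒞 : List (Subset n)) (axioms : CircuitAxioms (listFam 𝒞)) where

  open CircuitAxioms axioms
  open HornClosure 𝒞

  private
    variable
      B I J : Subset n

  Independent : Subset n → Set
  Independent = Avoids (listFam 𝒞)

  Independent? : Decidable Independent
  Independent? I = Dec.map (mk⇔ (λ ∄ C C∈𝒞 C⊆I → ∄ (C , C∈𝒞 , C⊆I))
                                (λ independent (C , C∈𝒞 , C⊆I) → independent C C∈𝒞 C⊆I))
                           (¬? (∃∈? (_⊆? I) 𝒞))

  dependent⇒circuit : ¬ Independent I → ∃ λ C → C ∈L 𝒞 × C ⊆ I
  dependent⇒circuit {I} dependent =
    decidable-stable (∃∈? (_⊆? I) 𝒞) (λ ∄ → dependent λ C C∈𝒞 C⊆I → ∄ (C , C∈𝒞 , C⊆I))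

  Independent-⊆ : J ⊆ I → Independent I → Independent J
  Independent-⊆ J⊆I independent C C∈𝒞 C⊆J = independent C C∈𝒞 (⊆-trans C⊆J J⊆I)

  Independent-⊥ : Independent ⊥
  Independent-⊥ C C∈𝒞 C⊆⊥ = C1 (subst (_∈L 𝒞) (⊆-antisym C⊆⊥ ⊥⊆) C∈𝒞)

  CircuitThrough : Fin n → Subset n → Set
  CircuitThrough f X = ∃ λ C → C ∈L 𝒞 × f ∈ C × C ⊆ X

  CircuitThrough? : ∀ f X → Dec (CircuitThrough f X)
  CircuitThrough? f X = ∃∈? (λ C → f ∈? C ×-dec C ⊆? X) 𝒞

  strong-elimination : ∀ {C₁ C₂ e f} → C₁ ∈L 𝒞 → C₂ ∈L 𝒞 → e ∈ C₁ → e ∈ C₂ → f ∈ C₁ → f ∉ C₂ →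
                       CircuitThrough f ((C₁ ∪ C₂) - e)
  -- If the circuit C₃ given by (C3) misses f, it leaves C₁ at some g ∈ C₂; eliminating g from
  -- C₂, C₃ (keeping e) and then e from C₁ and the result (keeping f) both happen in strictly
  -- smaller unions.
  strong-elimination = go (⊂-wellFounded _)
    where
    go : ∀ {C₁ C₂ e f} → Acc _⊂_ (C₁ ∪ C₂) → C₁ ∈L 𝒞 → C₂ ∈L 𝒞 → e ∈ C₁ → e ∈ C₂ → f ∈ C₁ → f ∉ C₂ →
         CircuitThrough f ((C₁ ∪ C₂) - e)
    go {C₁} {C₂} {e} {f} (acc smaller) C₁∈𝒞 C₂∈𝒞 e∈C₁ e∈C₂ f∈C₁ f∉C₂
      with C3 C₁ C₂ e C₁∈𝒞 C₂∈𝒞 (λ { refl → f∉C₂ f∈C₁ }) e∈C₁ e∈C₂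
    ... | C₃ , C₃∈𝒞 , C₃⊆ with f ∈? C₃
    ...   | yes f∈C₃ = C₃ , C₃∈𝒞 , f∈C₃ , C₃⊆
    ...   | no  f∉C₃
      with g , g∈C₃ , g∉C₁ ← ⊈-witness (λ C₃⊆C₁ → C2 C₃ C₁ C₃∈𝒞 C₁∈𝒞 (C₃⊆C₁ , f , f∈C₁ , f∉C₃))
      with C₄ , C₄∈𝒞 , e∈C₄ , C₄⊆ ←
             go (smaller (∪⊂ (q⊆p∪q C₁ C₂) (⊆-y⇒⊆ C₃⊆) (p⊆p∪q C₂ f∈C₁) f∉C₂ f∉C₃))
                C₂∈𝒞 C₃∈𝒞 (x∈p∪q∧x∉p⇒x∈q (⊆-y⇒⊆ C₃⊆ g∈C₃) g∉C₁) g∈C₃ e∈C₂ (⊆-y⇒∉ C₃⊆)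
      with C₅ , C₅∈𝒞 , f∈C₅ , C₅⊆ ←
             go (smaller (∪⊂ (p⊆p∪q C₂) (⊆-trans (⊆-y⇒⊆ C₄⊆) (∪-least (q⊆p∪q C₁ C₂) (⊆-y⇒⊆ C₃⊆)))
                             (⊆-y⇒⊆ C₃⊆ g∈C₃) g∉C₁ (⊆-y⇒∉ C₄⊆)))
                C₁∈𝒞 C₄∈𝒞 e∈C₁ e∈C₄ f∈C₁ (λ f∈C₄ → [ f∉C₂ , f∉C₃ ]′ (x∈p∪q⁻ C₂ C₃ (⊆-y⇒⊆ C₄⊆ f∈C₄)))
      = C₅ , C₅∈𝒞 , f∈C₅ , ⊆-trans C₅⊆ (-‿mono (∪-least (p⊆p∪q C₂) (⊆-trans (⊆-y⇒⊆ C₄⊆) C₂∪C₃⊆C₁∪C₂)))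
      where
      C₂∪C₃⊆C₁∪C₂ : C₂ ∪ C₃ ⊆ C₁ ∪ C₂
      C₂∪C₃⊆C₁∪C₂ = ∪-least (q⊆p∪q C₁ C₂) (⊆-y⇒⊆ C₃⊆)

  InCircuitClosure : Subset n → Fin n → Set
  InCircuitClosure I y = y ∈ I ⊎ CircuitThrough y (I ∪ ⁅ y ⁆)

  InCircuitClosure? : ∀ I y → Dec (InCircuitClosure I y)
  InCircuitClosure? I y = y ∈? I ⊎-dec CircuitThrough? y (I ∪ ⁅ y ⁆)

  circuitClosure : Subset n → Subset n
  circuitClosure I = ⟦ InCircuitClosure? I ⟧

  ⊆circuitClosure : I ⊆ circuitClosure I
  ⊆circuitClosure {I} = ∈⟦⟧⁺ (InCircuitClosure? I) ∘ inj₁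

  circuitClosure-closed : Closed (circuitClosure I)
  -- By induction on C ∖ I: a point y ∈ C ∖ (I ∪ {v}) lies on a circuit inside I ∪ {y}, and strong
  -- elimination of y yields a circuit through v with fewer points outside I.
  circuitClosure-closed {I} = closed-intro (go (⊂-wellFounded _))
    where
    D : Subset n
    D = circuitClosure I
    go : ∀ {C v} → Acc _⊂_ (C ∩ ∁ I) → C ∈L 𝒞 → v ∈ C → C - v ⊆ D → v ∈ D
    go {C} {v} (acc smaller) C∈𝒞 v∈C C-v⊆D with v ∈? I | C ⊆? I ∪ ⁅ v ⁆
    ... | yes v∈I | _      = ⊆circuitClosure v∈I
    ... | no  _   | yes C⊆ = ∈⟦⟧⁺ (InCircuitClosure? I) (inj₂ (C , C∈𝒞 , v∈C , C⊆))
    ... | no  v∉I | no  C⊈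
      with y , y∈C , y∉I∪v ← ⊈-witness C⊈
      with ∈⟦⟧⁻ (InCircuitClosure? I) (C-v⊆D (x∈p∧x≢y⇒x∈p-y y∈C λ { refl → y∉I∪v y∈p∪⁅y⁆ }))
    ... | inj₁ y∈I = ⊥-elim (y∉I∪v (p⊆p∪⁅y⁆ y∈I))
    ... | inj₂ (Cy , Cy∈𝒞 , y∈Cy , Cy⊆)
      with C₃ , C₃∈𝒞 , v∈C₃ , C₃⊆ ← strong-elimination C∈𝒞 Cy∈𝒞 y∈C y∈Cy v∈C
             (λ v∈Cy → [ v∉I , (λ { refl → y∉I∪v y∈p∪⁅y⁆ }) ]′ (x∈p∪⁅y⁆⁻ (Cy⊆ v∈Cy)))
      = go (smaller C₃∖I⊂C∖I) C₃∈𝒞 v∈C₃ C₃-v⊆D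
      where
      C₃⊆C∪I : C₃ ⊆ C ∪ I
      C₃⊆C∪I = ⊆-trans C₃⊆ (p∪q-y⊆p∪r Cy⊆)
      C₃∖I⊂C∖I : C₃ ∩ ∁ I ⊂ C ∩ ∁ I
      C₃∖I⊂C∖I = ⊆∪⇒∩∁⊆ C₃⊆C∪I , y , x∈p∩q⁺ (y∈C , x∉p⇒x∈∁p (y∉I∪v ∘ p⊆p∪⁅y⁆))
                                  , ⊆-y⇒∉ C₃⊆ ∘ proj₁ ∘ x∈p∩q⁻ C₃ (∁ I)
      C₃-v⊆D : C₃ - v ⊆ D
      C₃-v⊆D z∈ = [ (λ z∈C → C-v⊆D (x∈p∧x≢y⇒x∈p-y z∈C (x∈p-y⇒x≢y z∈))) , ⊆circuitClosure ]′
                    (x∈p∪q⁻ C I (C₃⊆C∪I (p-y⊆p z∈)))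

  Independent-∪⁅⁆⇒∉cl : y ∉ I → Independent (I ∪ ⁅ y ⁆) → y ∉ cl I
  Independent-∪⁅⁆⇒∉cl {y} {I} y∉I independent y∈clI
    with ∈⟦⟧⁻ (InCircuitClosure? I) (cl-least circuitClosure-closed ⊆circuitClosure y∈clI)
  ... | inj₁ y∈I                = y∉I y∈I
  ... | inj₂ (C , C∈𝒞 , _ , C⊆) = independent C C∈𝒞 C⊆

  ∉cl⇒Independent-∪⁅⁆ : Independent I → y ∉ cl I → Independent (I ∪ ⁅ y ⁆)
  ∉cl⇒Independent-∪⁅⁆ {I} {y} independent y∉clI = decidable-stable (Independent? _) λ dependent →
    let C , C∈𝒞 , C⊆ = dependent⇒circuit dependent
        y∈C = decidable-stable (y ∈? C) (λ y∉C → independent C C∈𝒞 (⊆∪⁅y⁆∧y∉⇒⊆ C⊆ y∉C))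
    in y∉clI (cl-rule C∈𝒞 y∈C (⊆∪⁅y⁆⇒-y⊆ C⊆))

  ∃Maximal-Independent-⊆ : ∀ S → ∃ (Maximal (λ X → Independent X × X ⊆ S))
  ∃Maximal-Independent-⊆ S =
    let B , maxB , _ = Maximal-above (λ X → Independent? X ×-dec X ⊆? S) (Independent-⊥ , ⊥⊆) in B , maxB

  Maximal-Independent-⊆⇒⊆cl : Maximal (λ X → Independent X × X ⊆ S) B → S ⊆ cl B
  Maximal-Independent-⊆⇒⊆cl {B = B} ((independent , B⊆S) , max) {y} y∈S =
    decidable-stable (y ∈? cl B) λ y∉clB →
      let B∪y≡B = max (B ∪ ⁅ y ⁆) (∉cl⇒Independent-∪⁅⁆ independent y∉clB , ∪⁅⁆-least B⊆S y∈S) p⊆p∪⁅y⁆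
      in y∉clB (cl-extensive (subst (y ∈_) B∪y≡B y∈p∪⁅y⁆))

  Maximal-Independent⇒Spanning : Maximal Independent B → Spanning B
  Maximal-Independent⇒Spanning (independentB , max) =
    Maximal-Independent-⊆⇒⊆cl ((independentB , ⊆⊤) , λ K (independentK , _) → max K independentK)

  Independent∧Spanning⇒Maximal : Independent I → Spanning I → Maximal Independent I
  Independent∧Spanning⇒Maximal {I} independentI spanningI =
    independentI , λ J independentJ I⊆J → ⊆-antisym (J⊆I independentJ I⊆J) I⊆J
    where
    J⊆I : Independent J → I ⊆ J → J ⊆ I
    J⊆I independentJ I⊆J {x} x∈J = decidable-stable (x ∈? I) λ x∉I →
      Independent-∪⁅⁆⇒∉cl x∉I (Independent-⊆ (∪⁅⁆-least I⊆J x∈J) independentJ) (spanningI ∈⊤)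

  Minimal-Spanning⇒Independent : Minimal Spanning K → Independent K
  Minimal-Spanning⇒Independent {K} (spanningK , min) C C∈𝒞 C⊆K
    with v , v∈C ← ≢⊥⇒Nonempty (λ C≡⊥ → C1 (subst (_∈L 𝒞) C≡⊥ C∈𝒞))
    = y∉p-y K v (subst (v ∈_) (sym K-v≡K) (C⊆K v∈C))
    where
    K⊆cl[K-v] : K ⊆ cl (K - v)
    K⊆cl[K-v] = ⊆-trans p⊆p-y∪⁅y⁆ (∪⁅⁆-least cl-extensive (cl-rule C∈𝒞 v∈C (-‿mono C⊆K)))
    K-v≡K : K - v ≡ K
    K-v≡K = min (K - v) (Spanning-⊆cl K⊆cl[K-v] spanningK) p-y⊆p

  Minimal-Spanning≐Maximal-Independent : Minimal Spanning ≐ Maximal Independent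
  Minimal-Spanning≐Maximal-Independent K = mk⇔
    (λ minK → Independent∧Spanning⇒Maximal (Minimal-Spanning⇒Independent minK) (proj₁ minK))
    (λ (independentK , max) → Maximal-Independent⇒Spanning (independentK , max) , λ K′ spanningK′ K′⊆K →
       sym (proj₂ (Independent∧Spanning⇒Maximal (Independent-⊆ K′⊆K independentK) spanningK′) K independentK K′⊆K))

  Spanning⇒⊇basis : Spanning S → ∃ λ B → Maximal Independent B × B ⊆ S
  Spanning⇒⊇basis {S} spanningS =
    let B , maxB = ∃Maximal-Independent-⊆ S
        (independentB , B⊆S) = proj₁ maxB
    in B , Independent∧Spanning⇒Maximal independentB (Spanning-⊆cl (Maximal-Independent-⊆⇒⊆cl maxB) spanningS) , B⊆S

  ¬Spanning≐Avoids-bases : (¬_ ∘ Spanning) ≐ Avoids (Maximal Independent)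
  ¬Spanning≐Avoids-bases S = mk⇔
    (λ ¬spanningS B maxB B⊆S → ¬spanningS (Spanning-mono B⊆S (Maximal-Independent⇒Spanning maxB)))
    (λ (avoids : Avoids (Maximal Independent) S) (spanningS : Spanning S) → let B , maxB , B⊆S = Spanning⇒⊇basis spanningS in avoids B maxB B⊆S)

  ∉cl-basis-minus : Maximal Independent B → x ∈ B → x ∉ cl (B - x)
  ∉cl-basis-minus {B} {x} (independentB , _) x∈B =
    Independent-∪⁅⁆⇒∉cl (y∉p-y B x) (Independent-⊆ (∪⁅⁆-least p-y⊆p x∈B) independentB)

  exchange-spanning : Maximal Independent B → y ∉ cl (B - x) → Spanning ((B - x) ∪ ⁅ y ⁆)
  exchange-spanning {B} {y} {x} maxB y∉cl with y ≟ x
  ... | yes refl = Spanning-mono p⊆p-y∪⁅y⁆ (Maximal-Independent⇒Spanning maxB)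
  ... | no  y≢x  = Spanning-⊆cl B⊆clE (Maximal-Independent⇒Spanning maxB)
    where
    E : Subset n
    E = (B - x) ∪ ⁅ y ⁆
    B⊆E∪x : B ⊆ E ∪ ⁅ x ⁆
    B⊆E∪x = ⊆-trans p⊆p-y∪⁅y⁆ (∪⁅⁆-least (⊆-trans p⊆p∪⁅y⁆ p⊆p∪⁅y⁆) y∈p∪⁅y⁆)
    -- otherwise E ∪ {x} is independent and contains B, so y ∈ B - x
    x∈clE : x ∈ cl E
    x∈clE = decidable-stable (x ∈? cl E) λ x∉clE →
      let independentE = ∉cl⇒Independent-∪⁅⁆ (Independent-⊆ p-y⊆p (proj₁ maxB)) y∉cl
          E∪x≡B = proj₂ maxB (E ∪ ⁅ x ⁆) (∉cl⇒Independent-∪⁅⁆ independentE x∉clE) B⊆E∪x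
          y∈B = subst (y ∈_) E∪x≡B (p⊆p∪⁅y⁆ y∈p∪⁅y⁆)
      in y∉cl (cl-extensive (x∈p∧x≢y⇒x∈p-y y∈B y≢x))
    B⊆clE : B ⊆ cl E
    B⊆clE = ⊆-trans p⊆p-y∪⁅y⁆ (∪⁅⁆-least (⊆-trans p⊆p∪⁅y⁆ cl-extensive) x∈clE)

  cl-basis-minus-hyperplane : Maximal Independent B → x ∈ B → ℳ Closed (cl (B - x))
  cl-basis-minus-hyperplane {B} {x} maxB x∈B =
    (cl-closed , λ H≡⊤ → ∉cl-basis-minus maxB x∈B (subst (x ∈_) (sym H≡⊤) ∈⊤)) ,
    λ G (closedG , G≢⊤) H⊆G → ⊆-antisym (G⊆H closedG G≢⊤ H⊆G) H⊆G
    where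
    G⊆H : ∀ {G} → Closed G → G ≢ ⊤ → cl (B - x) ⊆ G → G ⊆ cl (B - x)
    G⊆H closedG G≢⊤ H⊆G {z} z∈G = decidable-stable (z ∈? _) λ z∉H → G≢⊤ (Closed∧Spanning⇒≡⊤ closedG
      (Spanning-mono (∪⁅⁆-least (⊆-trans cl-extensive H⊆G) z∈G) (exchange-spanning maxB z∉H)))

  hyperplane-separating : Closed S → x ∉ S → ∃ λ H → ℳ Closed H × S ⊆ H × x ∉ H
  hyperplane-separating {S} {x} closedS x∉S
    with I , maxI@((independentI , I⊆S) , _) ← ∃Maximal-Independent-⊆ S
    with B , maxB , I∪x⊆B ← Maximal-above Independent? (∉cl⇒Independent-∪⁅⁆ independentI (x∉S ∘ cl-least closedS I⊆S))
    = cl (B - x) , cl-basis-minus-hyperplane maxB x∈B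
                 , ⊆-trans (Maximal-Independent-⊆⇒⊆cl maxI) (cl-mono I⊆B-x)
                 , ∉cl-basis-minus maxB x∈B
    where
    x∉clI : x ∉ cl I
    x∉clI = x∉S ∘ cl-least closedS I⊆S
    x∈B : x ∈ B
    x∈B = I∪x⊆B y∈p∪⁅y⁆
    I⊆B-x : I ⊆ B - x
    I⊆B-x z∈I = x∈p∧x≢y⇒x∈p-y (I∪x⊆B (p⊆p∪⁅y⁆ z∈I)) λ { refl → x∉clI (cl-extensive z∈I) }

  Closed≐ℳ^∩ : Closed ≐ (ℳ Closed ^∩)
  Closed≐ℳ^∩ S = mk⇔
    (λ closedS → ⋂-separating (hyperplane-separating closedS))
    (λ (Hs , hyperplanes , S≡⋂) → subst Closed (sym S≡⋂) (Closed-⋂ (All.map (proj₁ ∘ proj₁) hyperplanes)))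


lemma8 : (n : ℕ) (Cs : List (Subset n)) → CircuitAxioms (listFam Cs) →
    (𝒦 (Φ (listFam Cs)) ≐ ((((listFam Cs) ᵈ) ᶜ)))
    × (ℳ (Φ (listFam Cs)) ≐ ((((((listFam Cs) ᵈ) ᶜ) ᵈ) ᶜ)))
    × (TrueSets (Φ (listFam Cs)) ≐ (((((((listFam Cs) ᵈ) ᶜ) ᵈ) ᶜ) ^∩)))
lemma8 n Cs axioms = 𝒦≐bases , ℳ≐hyperplanes , 𝒯≐flats
  where
  open Matroid Cs axioms
  open HornClosure Cs
  open ≐-Reasoning
  𝒞 : Family n
  𝒞 = listFam Cs

  𝒦≐bases : 𝒦 Closed ≐ ((𝒞 ᵈ) ᶜ)
  𝒦≐bases = begin
    𝒦 Closed             ≈⟨ Minimal-resp-≐ closure-≡⊤≐Spanning ⟩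
    Minimal Spanning     ≈⟨ Minimal-Spanning≐Maximal-Independent ⟩
    Maximal Independent  ≈⟨ ᵈᶜ≐Maximal-Avoids ⟨
    (𝒞 ᵈ) ᶜ              ∎

  ℳ≐hyperplanes : ℳ Closed ≐ ((((𝒞 ᵈ) ᶜ) ᵈ) ᶜ)
  ℳ≐hyperplanes = begin
    ℳ Closed                                ≈⟨ ℳ≐Maximal-¬Spanning ⟩
    Maximal (¬_ ∘ Spanning)                 ≈⟨ Maximal-resp-≐ ¬Spanning≐Avoids-bases ⟩
    Maximal (Avoids (Maximal Independent))  ≈⟨ Maximal-resp-≐ (Avoids-resp-≐ ᵈᶜ≐Maximal-Avoids) ⟨
    Maximal (Avoids ((𝒞 ᵈ) ᶜ))              ≈⟨ ᵈᶜ≐Maximal-Avoids ⟨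
    (((𝒞 ᵈ) ᶜ) ᵈ) ᶜ                         ∎

  𝒯≐flats : TrueSets Closed ≐ (((((𝒞 ᵈ) ᶜ) ᵈ) ᶜ) ^∩)
  𝒯≐flats = begin
    Closed                ≈⟨ Closed≐ℳ^∩ ⟩
    ℳ Closed ^∩           ≈⟨ ^∩-resp-≐ ℳ≐hyperplanes ⟩
    ((((𝒞 ᵈ) ᶜ) ᵈ) ᶜ) ^∩  ∎
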